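{- For each positive integer $k$ there exist a square-free integer $d>1$ and a unit $\eta$ of $\mathbb{Q}(\sqrt{d})$ such that the $k$-Fibonacci sequence coincides with the Fibonacci sequence of degree $d$ with respect to $\eta$, i.e. with $(F_{\eta,n})_{n\ge1}$.
   Context: For a positive integer $k$, the $k$-Fibonacci sequence is the sequence $(G_n)_{n\ge1}$ with $G_1=1$, $G_2=k$ and $G_{n+2}=kG_{n+1}+G_n$ for all $n\ge1$. For a unit $\eta=\alpha+\beta\sqrt d$ of $\mathbb{Q}(\sqrt d)$ with $\alpha,\beta\in\mathbb{Q}$, $\beta\neq0$, write $\eta^n=\alpha_n+\beta_n\sqrt d$ ($\alpha_n,\beta_n\in\mathbb{Q}$) for $n\ge1$; the Fibonacci sequence of degree $d$ with respect to $\eta$ is $F_{\eta,n}=\beta_n/\beta$, $n\ge1$. -}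

module Defs where

open import Data.Nat as ℕ using (ℕ; zero; suc)
open import Data.Nat.Divisibility using (_∣_)
open import Data.Integer as ℤ using (ℤ; +_)
open import Data.Rational as ℚ using (ℚ; _/_; 0ℚ; 1ℚ; _÷_; NonZero)
open import Data.Product using (_×_; _,_; proj₁; proj₂; ∃)
open import Relation.Binary.PropositionalEquality using (_≡_)

-- the k-Fibonacci sequence; G k 0 = 0 is an auxiliary value, the paper's
-- sequence is (G k n) for n ≥ 1, with G k 1 = 1, G k 2 = k.
G : ℕ → ℕ → ℕ
G k zero = 0
G k (suc zero) = 1
G k (suc (suc n)) = k ℕ.* G k (suc n) ℕ.+ G k n

SquareFree : ℕ → Set
SquareFree d = ∀ m → m ℕ.* m ∣ d → m ≡ 1

-- elements α + β √d of ℚ(√d), represented as pairs (α , β)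
QF : Set
QF = ℚ × ℚ

mul : ℕ → QF → QF → QF
mul d (a , b) (c , e) =
  (a ℚ.* c ℚ.+ ((+ d) / 1) ℚ.* b ℚ.* e , a ℚ.* e ℚ.+ b ℚ.* c)

pow : ℕ → QF → ℕ → QF
pow d η zero = (1ℚ , 0ℚ)
pow d η (suc n) = mul d η (pow d η n)

IsInt : ℚ → Set
IsInt q = ∃ λ (z : ℤ) → q ≡ z / 1

-- algebraic integer of ℚ(√d): α + β√d is a root of the monic polynomial
-- X² - 2α X + (α² - d β²), which has integer coefficients
-- (equivalently, its minimal polynomial over ℚ does)
IsAlgInt : ℕ → QF → Set
IsAlgInt d (a , b) =
  IsInt ((+ 2 / 1) ℚ.* a) × IsInt (a ℚ.* a ℚ.- ((+ d) / 1) ℚ.* b ℚ.* b)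

IsUnit : ℕ → QF → Set
IsUnit d η = IsAlgInt d η × ∃ λ (ε : QF) → IsAlgInt d ε × mul d η ε ≡ (1ℚ , 0ℚ)

F : (d : ℕ) → (η : QF) → NonZero (proj₂ η) → ℕ → ℚ
F d η nz n = _÷_ (proj₂ (pow d η n)) (proj₂ η) {{nz}}

-- Write k² + 4 = m² d with d square-free; since k² + 4 is never a perfect
-- square, d > 1.  Then η = (k + m√d)/2 has trace k and norm (k² − d m²)/4 = −1,
-- so it is a unit, and the powers of any η = α + β√d satisfy
-- η^n = U_n α − N U_{n−1} + U_n β √d, where U is the Lucas sequence of the
-- trace and norm N of η.  For η as above, U_n(k, −1) is exactly G_n.
module Submission where

open import Defs
open import Data.Nat as ℕ using (ℕ; zero; suc; _≤_; _<_; z≤n; s≤s; z<s)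
open import Data.Product using (Σ; _×_; _,_; proj₂; ∃; ∃₂)
open import Data.Sum using (_⊎_; inj₁; inj₂)
open import Relation.Nullary using (yes; no; contradiction)
open import Relation.Nullary.Decidable using (_×-dec_)
open import Relation.Binary.PropositionalEquality

module _ where
  open import Data.Nat using (_+_; _*_; NonZero)
  open import Data.Nat.Properties
  open import Data.Nat.Divisibility using (_∣_; _∣?_; divides; ∣⇒≤; 0∣⇒≡0)
  open import Data.Nat.Induction using (<-rec)
  open import Data.Nat.Solver using (module +-*-Solver)
  open +-*-Solver

  square-cancel-< : ∀ {m n} → m * m < n * n → m < n
  square-cancel-< mm<nn = ≰⇒> (λ n≤m → <⇒≱ mm<nn (*-mono-≤ n≤m n≤m))

  k+k≢3 : ∀ k → k + k ≢ 3
  k+k≢3 zero ()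
  k+k≢3 (suc zero) ()
  k+k≢3 (suc (suc k)) rewrite +-suc k (suc k) | +-suc k k = λ ()

  -- k² < k² + 4 < (k + 2)², and (k + 1)² = k² + 4 would make 2k + 1 = 4.
  square≢square+4 : ∀ k m → 1 ≤ k → m * m ≢ k * k + 4
  square≢square+4 k m 1≤k mm≡kk+4 = k+k≢3 k (+-cancelˡ-≡ (k * k) _ _ (suc-injective expand))
    where
    k<m : k < m
    k<m = square-cancel-< (subst (k * k <_) (sym mm≡kk+4) (m<m+n (k * k) z<s))
    m<k+2 : m < 2 + k
    m<k+2 = square-cancel-< (begin-strict
      m * m                 ≡⟨ mm≡kk+4 ⟩
      k * k + 4             <⟨ m<m+n (k * k + 4) (≤-trans 1≤k (m≤n*m k 4)) ⟩
      k * k + 4 + 4 * k     ≡⟨ solve 1 (λ k → k :* k :+ con 4 :+ con 4 :* k := (con 2 :+ k) :* (con 2 :+ k)) refl k ⟩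
      (2 + k) * (2 + k)     ∎)
      where open ≤-Reasoning
    m≡1+k : m ≡ suc k
    m≡1+k = ≤-antisym (≤-pred m<k+2) k<m
    expand : suc (k * k + (k + k)) ≡ suc (k * k + 3)
    expand = begin
      suc (k * k + (k + k)) ≡⟨ solve 1 (λ k → con 1 :+ (k :* k :+ (k :+ k)) := (con 1 :+ k) :* (con 1 :+ k)) refl k ⟩
      suc k * suc k         ≡⟨ cong (λ x → x * x) (sym m≡1+k) ⟩
      m * m                 ≡⟨ mm≡kk+4 ⟩
      k * k + 4             ≡⟨ +-suc (k * k) 3 ⟩
      suc (k * k + 3)       ∎
      where open ≡-Reasoning

  squareFree-or-square∣ : ∀ n → .{{NonZero n}} → SquareFree n ⊎ ∃ λ j → 2 ≤ j × j * j ∣ n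
  squareFree-or-square∣ n with anyUpTo? (λ j → (2 ≤? j) ×-dec (j * j ∣? n)) (suc n)
  ... | yes (j , _ , 2≤j , jj∣n) = inj₂ (j , 2≤j , jj∣n)
  ... | no ¬square∣ = inj₁ squareFree
    where
    squareFree : SquareFree n
    squareFree zero 0∣n = contradiction (0∣⇒≡0 0∣n) (ℕ.≢-nonZero⁻¹ n)
    squareFree (suc zero) _ = refl
    squareFree j@(suc (suc _)) jj∣n =
      contradiction (j , s≤s (≤-trans (m≤m*n j j) (∣⇒≤ jj∣n)) , s≤s (s≤s z≤n) , jj∣n) ¬square∣

  SquareFreeDecomposition : ℕ → Set
  SquareFreeDecomposition n = ∃₂ λ m d → n ≡ m * m * d × SquareFree d

  squareFree-decomposition : ∀ n → .{{NonZero n}} → SquareFreeDecomposition n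
  squareFree-decomposition = <-rec _ extract
    where
    extract : ∀ n → (∀ {q} → q < n → .{{NonZero q}} → SquareFreeDecomposition q) →
              .{{NonZero n}} → SquareFreeDecomposition n
    extract n smaller with squareFree-or-square∣ n
    ... | inj₁ squareFree = 1 , n , sym (*-identityˡ n) , squareFree
    ... | inj₂ (j , 2≤j , divides q n≡q*jj) = absorb-j (smaller q<n)
      where
      instance
        q≢0 : NonZero q
        q≢0 = ℕ.≢-nonZero (λ q≡0 → ℕ.≢-nonZero⁻¹ n (trans n≡q*jj (cong (_* (j * j)) q≡0)))
      q<n : q < n
      q<n = subst (q <_) (sym n≡q*jj)
              (m<m*n q (j * j) (≤-trans 2≤j (m≤m*n j j {{ℕ.>-nonZero (≤-trans z<s 2≤j)}})))
      absorb-j : SquareFreeDecomposition q → SquareFreeDecomposition n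
      absorb-j (m , d , q≡m*m*d , squareFree) = m * j , d , n≡mj*mj*d , squareFree
        where
        n≡mj*mj*d : n ≡ m * j * (m * j) * d
        n≡mj*mj*d = trans n≡q*jj (trans (cong (_* (j * j)) q≡m*m*d)
                      (solve 3 (λ m j d → m :* m :* d :* (j :* j) := m :* j :* (m :* j) :* d) refl m j d))

  k*k+4-decomposition : ∀ k → 1 ≤ k →
    ∃₂ λ m d → 0 < m × 1 < d × SquareFree d × d * m * m ≡ k * k + 4
  k*k+4-decomposition k 1≤k with squareFree-decomposition (k * k + 4) {{ℕ.≢-nonZero (m+1+n≢0 (k * k))}}
  ... | zero , _ , n≡0 , _ = contradiction n≡0 (m+1+n≢0 (k * k))
  ... | suc m , zero , n≡mm*0 , _ =
    contradiction (trans n≡mm*0 (*-zeroʳ (suc m * suc m))) (m+1+n≢0 (k * k))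
  ... | suc m , suc zero , n≡mm*1 , _ =
    contradiction (sym (trans n≡mm*1 (*-identityʳ (suc m * suc m)))) (square≢square+4 k (suc m) 1≤k)
  ... | suc m , d@(suc (suc _)) , n≡mm*d , squareFree =
    suc m , d , z<s , s≤s (s≤s z≤n) , squareFree ,
    trans (*-assoc d (suc m) (suc m)) (trans (*-comm d (suc m * suc m)) (sym n≡mm*d))

open import Data.Integer as ℤ using (ℤ; +_; -[1+_])
import Data.Integer.Properties as ℤP
open import Data.Rational using (ℚ; _/_; 0ℚ; 1ℚ; ½; _+_; _*_; -_; _-_; 1/_; toℚᵘ; NonZero; Positive)
open import Data.Rational.Properties
  using (toℚᵘ-injective; toℚᵘ-fromℚᵘ; toℚᵘ-homo-+; toℚᵘ-homo-*; toℚᵘ-homo‿-;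
         *-assoc; *-inverseʳ; *-identityʳ; normalize-pos; pos*pos⇒pos; pos⇒nonZero)
import Data.Rational.Unnormalised as ℚᵘ
import Data.Rational.Unnormalised.Properties as ℚᵘP
open import Data.Rational.Solver using (module +-*-Solver)
open +-*-Solver

ι : ℤ → ℚ
ι i = i / 1

ι⁺ : ℕ → ℚ
ι⁺ n = ι (+ n)

module _ where
  open ℚᵘ using (_≃_; *≡*; mkℚᵘ)
  open ℚᵘP.≃-Reasoning

  toℚᵘ-ι : ∀ i → toℚᵘ (ι i) ≃ mkℚᵘ i 0
  toℚᵘ-ι i = toℚᵘ-fromℚᵘ (mkℚᵘ i 0)

  ι-+ : ∀ i j → ι (i ℤ.+ j) ≡ ι i + ι j
  ι-+ i j = toℚᵘ-injective (begin
    toℚᵘ (ι (i ℤ.+ j))            ≈⟨ toℚᵘ-ι (i ℤ.+ j) ⟩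
    mkℚᵘ (i ℤ.+ j) 0              ≈⟨ *≡* (cong₂ (λ a b → (a ℤ.+ b) ℤ.* ℤ.1ℤ) (ℤP.*-identityʳ i) (ℤP.*-identityʳ j)) ⟨
    mkℚᵘ i 0 ℚᵘ.+ mkℚᵘ j 0        ≈⟨ ℚᵘP.+-cong (toℚᵘ-ι i) (toℚᵘ-ι j) ⟨
    toℚᵘ (ι i) ℚᵘ.+ toℚᵘ (ι j)    ≈⟨ toℚᵘ-homo-+ (ι i) (ι j) ⟨
    toℚᵘ (ι i + ι j)              ∎)

  ι-* : ∀ i j → ι (i ℤ.* j) ≡ ι i * ι j
  ι-* i j = toℚᵘ-injective (begin
    toℚᵘ (ι (i ℤ.* j))            ≈⟨ toℚᵘ-ι (i ℤ.* j) ⟩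
    mkℚᵘ i 0 ℚᵘ.* mkℚᵘ j 0        ≈⟨ ℚᵘP.*-cong (toℚᵘ-ι i) (toℚᵘ-ι j) ⟨
    toℚᵘ (ι i) ℚᵘ.* toℚᵘ (ι j)    ≈⟨ toℚᵘ-homo-* (ι i) (ι j) ⟨
    toℚᵘ (ι i * ι j)              ∎)

  ι-neg : ∀ i → ι (ℤ.- i) ≡ - ι i
  ι-neg i = toℚᵘ-injective (begin
    toℚᵘ (ι (ℤ.- i))              ≈⟨ toℚᵘ-ι (ℤ.- i) ⟩
    ℚᵘ.- mkℚᵘ i 0                 ≈⟨ ℚᵘP.-‿cong (toℚᵘ-ι i) ⟨
    ℚᵘ.- toℚᵘ (ι i)               ≈⟨ toℚᵘ-homo‿- (ι i) ⟨
    toℚᵘ (- ι i)                  ∎)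

ι⁺-+ : ∀ m n → ι⁺ (m ℕ.+ n) ≡ ι⁺ m + ι⁺ n
ι⁺-+ m n = ι-+ (+ m) (+ n)

ι⁺-* : ∀ m n → ι⁺ (m ℕ.* n) ≡ ι⁺ m * ι⁺ n
ι⁺-* m n = trans (cong ι (ℤP.pos-* m n)) (ι-* (+ m) (+ n))

IsInt-neg : ∀ {q} → IsInt q → IsInt (- q)
IsInt-neg (z , refl) = ℤ.- z , sym (ι-neg z)

-- Spelled out exactly as in IsAlgInt, so that IsAlgInt d η is
-- definitionally IsInt (trace η) × IsInt (norm d η).
trace : QF → ℚ
trace (α , β) = (+ 2 / 1) * α

norm : ℕ → QF → ℚ
norm d (α , β) = α * α - ι⁺ d * β * β

lucasU : ℚ → ℚ → ℕ → ℚ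
lucasU P Q zero = 0ℚ
lucasU P Q (suc zero) = 1ℚ
lucasU P Q (suc (suc n)) = P * lucasU P Q (suc n) - Q * lucasU P Q n

-- The step uses α² + d β² = trace·α − norm, i.e. that α + β√d is a root of
-- X² − trace·X + norm.
pow-suc-lucasU : ∀ d α β n → let U = lucasU (trace (α , β)) (norm d (α , β)) in
  pow d (α , β) (suc n) ≡ (U (suc n) * α - norm d (α , β) * U n , U (suc n) * β)
pow-suc-lucasU d α β zero = cong₂ _,_
  (solve 3 (λ α β D → α :* con 1ℚ :+ D :* β :* con 0ℚ := con 1ℚ :* α :- (α :* α :- D :* β :* β) :* con 0ℚ)
         refl α β (ι⁺ d))
  (solve 2 (λ α β → α :* con 0ℚ :+ β :* con 1ℚ := con 1ℚ :* β) refl α β)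
pow-suc-lucasU d α β (suc n) = trans (cong (mul d (α , β)) (pow-suc-lucasU d α β n)) (cong₂ _,_
  (solve 5 (λ α β D u v → α :* (v :* α :- (α :* α :- D :* β :* β) :* u) :+ D :* β :* (v :* β)
                      := (con (+ 2 / 1) :* α :* v :- (α :* α :- D :* β :* β) :* u) :* α
                         :- (α :* α :- D :* β :* β) :* v)
         refl α β (ι⁺ d) (U n) (U (suc n)))
  (solve 5 (λ α β D u v → α :* (v :* β) :+ β :* (v :* α :- (α :* α :- D :* β :* β) :* u)
                      := (con (+ 2 / 1) :* α :* v :- (α :* α :- D :* β :* β) :* u) :* β)
         refl α β (ι⁺ d) (U n) (U (suc n))))
  where
  U : ℕ → ℚ
  U = lucasU (trace (α , β)) (norm d (α , β))

F-lucasU : ∀ d η nz n → F d η nz (suc n) ≡ lucasU (trace η) (norm d η) (suc n)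
F-lucasU d η@(α , β) nz n = begin
  proj₂ (pow d η (suc n)) * 1/ β  ≡⟨ cong (λ p → proj₂ p * 1/ β) (pow-suc-lucasU d α β n) ⟩
  U (suc n) * β * 1/ β            ≡⟨ *-assoc (U (suc n)) β (1/ β) ⟩
  U (suc n) * (β * 1/ β)          ≡⟨ cong (U (suc n) *_) (*-inverseʳ β) ⟩
  U (suc n) * 1ℚ                  ≡⟨ *-identityʳ (U (suc n)) ⟩
  U (suc n)                       ∎
  where
  open ≡-Reasoning
  instance
    β≢0 : NonZero β
    β≢0 = nz
  U : ℕ → ℚ
  U = lucasU (trace η) (norm d η)

mul-negConj : ∀ d α β → mul d (α , β) (- α , β) ≡ (- norm d (α , β) , 0ℚ)
mul-negConj d α β = cong₂ _,_
  (solve 3 (λ α β D → α :* (:- α) :+ D :* β :* β := :- (α :* α :- D :* β :* β)) refl α β (ι⁺ d))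
  (solve 2 (λ α β → α :* β :+ β :* (:- α) := con 0ℚ) refl α β)

isAlgInt-negConj : ∀ d α β → IsAlgInt d (α , β) → IsAlgInt d (- α , β)
isAlgInt-negConj d α β (trace∈ℤ , norm∈ℤ) =
    subst IsInt (solve 1 (λ α → :- (con (+ 2 / 1) :* α) := con (+ 2 / 1) :* (:- α)) refl α)
      (IsInt-neg trace∈ℤ)
  , subst IsInt (solve 3 (λ α β D → α :* α :- D :* β :* β := (:- α) :* (:- α) :- D :* β :* β) refl α β (ι⁺ d))
      norm∈ℤ

-- A unit of norm −1 is inverted by minus its conjugate.
norm≡-1⇒isUnit : ∀ d η → IsInt (trace η) → norm d η ≡ - 1ℚ → IsUnit d η
norm≡-1⇒isUnit d η@(α , β) trace∈ℤ norm≡-1 =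
  isAlgInt , (- α , β) , isAlgInt-negConj d α β isAlgInt ,
  trans (mul-negConj d α β) (cong (λ N → - N , 0ℚ) norm≡-1)
  where
  isAlgInt : IsAlgInt d η
  isAlgInt = trace∈ℤ , -[1+ 0 ] , norm≡-1

lucasU-G : ∀ k n → lucasU (ι⁺ k) (- 1ℚ) n ≡ ι⁺ (G k n)
lucasU-G k zero = refl
lucasU-G k (suc zero) = refl
lucasU-G k (suc (suc n)) = begin
  ι⁺ k * U (suc n) - - 1ℚ * U n         ≡⟨ solve 3 (λ x u v → x :* v :- (:- con 1ℚ) :* u := x :* v :+ u)
                                                   refl (ι⁺ k) (U n) (U (suc n)) ⟩
  ι⁺ k * U (suc n) + U n                ≡⟨ cong₂ (λ u v → ι⁺ k * v + u) (lucasU-G k n) (lucasU-G k (suc n)) ⟩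
  ι⁺ k * ι⁺ (G k (suc n)) + ι⁺ (G k n)  ≡⟨ cong (_+ ι⁺ (G k n)) (ι⁺-* k (G k (suc n))) ⟨
  ι⁺ (k ℕ.* G k (suc n)) + ι⁺ (G k n)   ≡⟨ ι⁺-+ (k ℕ.* G k (suc n)) (G k n) ⟨
  ι⁺ (G k (suc (suc n)))                ∎
  where
  open ≡-Reasoning
  U : ℕ → ℚ
  U = lucasU (ι⁺ k) (- 1ℚ)

halfSum : ℕ → ℕ → QF
halfSum k m = (ι⁺ k * ½ , ι⁺ m * ½)

halfSum-nonZero : ∀ k m → 0 < m → NonZero (proj₂ (halfSum k m))
halfSum-nonZero k m 0<m = pos⇒nonZero (ι⁺ m * ½) {{pos*pos⇒pos (ι⁺ m) {{ι⁺m-pos}} ½}}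
  where
  ι⁺m-pos : Positive (ι⁺ m)
  ι⁺m-pos = normalize-pos m 1 {{_}} {{ℕ.>-nonZero 0<m}}

trace-halfSum : ∀ k m → trace (halfSum k m) ≡ ι⁺ k
trace-halfSum k m = solve 1 (λ x → con (+ 2 / 1) :* (x :* con ½) := x) refl (ι⁺ k)

norm-halfSum : ∀ k m d → d ℕ.* m ℕ.* m ≡ k ℕ.* k ℕ.+ 4 → norm d (halfSum k m) ≡ - 1ℚ
norm-halfSum k m d d*m*m≡k*k+4 = begin
  ι⁺ k * ½ * (ι⁺ k * ½) - ι⁺ d * (ι⁺ m * ½) * (ι⁺ m * ½)
    ≡⟨ solve 3 (λ x y D → x :* con ½ :* (x :* con ½) :- D :* (y :* con ½) :* (y :* con ½)
                         := (x :* x :- D :* y :* y) :* con (½ * ½)) refl (ι⁺ k) (ι⁺ m) (ι⁺ d) ⟩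
  (ι⁺ k * ι⁺ k - ι⁺ d * ι⁺ m * ι⁺ m) * (½ * ½)
    ≡⟨ cong (λ D → (ι⁺ k * ι⁺ k - D) * (½ * ½)) dmm≡kk+4 ⟩
  (ι⁺ k * ι⁺ k - (ι⁺ k * ι⁺ k + ι⁺ 4)) * (½ * ½)
    ≡⟨ solve 1 (λ x → (x :* x :- (x :* x :+ con (ι⁺ 4))) :* con (½ * ½) := :- con 1ℚ) refl (ι⁺ k) ⟩
  - 1ℚ ∎
  where
  open ≡-Reasoning
  dmm≡kk+4 : ι⁺ d * ι⁺ m * ι⁺ m ≡ ι⁺ k * ι⁺ k + ι⁺ 4
  dmm≡kk+4 = begin
    ι⁺ d * ι⁺ m * ι⁺ m    ≡⟨ cong (_* ι⁺ m) (ι⁺-* d m) ⟨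
    ι⁺ (d ℕ.* m) * ι⁺ m   ≡⟨ ι⁺-* (d ℕ.* m) m ⟨
    ι⁺ (d ℕ.* m ℕ.* m)    ≡⟨ cong ι⁺ d*m*m≡k*k+4 ⟩
    ι⁺ (k ℕ.* k ℕ.+ 4)    ≡⟨ ι⁺-+ (k ℕ.* k) 4 ⟩
    ι⁺ (k ℕ.* k) + ι⁺ 4   ≡⟨ cong (_+ ι⁺ 4) (ι⁺-* k k) ⟩
    ι⁺ k * ι⁺ k + ι⁺ 4    ∎

corollary29 : (k : ℕ) → 1 ≤ k →
    ∃ λ (d : ℕ) → 1 < d × SquareFree d ×
    ∃ λ (η : QF) → IsUnit d η ×
    Σ (NonZero (proj₂ η)) λ nz →
    ∀ (n : ℕ) → 1 ≤ n → F d η nz n ≡ (+ G k n) / 1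
corollary29 k 1≤k with k*k+4-decomposition k 1≤k
... | m , d , 0<m , 1<d , squareFree , d*m*m≡k*k+4 =
  d , 1<d , squareFree , η , norm≡-1⇒isUnit d η (+ k , trace-η) norm-η , nz , F≡G
  where
  η : QF
  η = halfSum k m
  nz : NonZero (proj₂ η)
  nz = halfSum-nonZero k m 0<m
  trace-η : trace η ≡ ι⁺ k
  trace-η = trace-halfSum k m
  norm-η : norm d η ≡ - 1ℚ
  norm-η = norm-halfSum k m d d*m*m≡k*k+4
  F≡G : ∀ n → 1 ≤ n → F d η nz n ≡ ι⁺ (G k n)
  F≡G (suc n) _ = begin
    F d η nz (suc n)                    ≡⟨ F-lucasU d η nz n ⟩
    lucasU (trace η) (norm d η) (suc n) ≡⟨ cong₂ (λ P Q → lucasU P Q (suc n)) trace-η norm-η ⟩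
    lucasU (ι⁺ k) (- 1ℚ) (suc n)        ≡⟨ lucasU-G k (suc n) ⟩
    ι⁺ (G k (suc n))                    ∎
    where open ≡-Reasoning
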